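{- We have $$G^+_{213}(x)=G^+_{132}(x)=\frac{x^3}{1-x-x^2}\qquad\text{and}\qquad G^-_{213}(x)=G^-_{132}(x)=-\frac{x^3}{1-x+x^2}.$$
   Context: A subsequence has type $\sigma$ if it has the same relative order as $\sigma$. For a permutation $\pi$, $I(3412;\pi)$ is the set of involutions of any length that avoid $3412$ and contain exactly one subsequence of type $\pi$. Then $G^+_\pi(x)=\sum_{\sigma\in I(3412;\pi)}x^{|\sigma|}$ and $G^-_\pi(x)=\sum_{\sigma\in I(3412;\pi)}\operatorname{sign}(\sigma)x^{|\sigma|}$, where $\operatorname{sign}(\sigma)=\pm1$ is the sign of $\sigma$. -}

module Defs where

open import Data.Bool using (Bool; true; false; _∧_; if_then_else_; not)
open import Data.Nat using (ℕ; zero; suc; _<ᵇ_; _≡ᵇ_)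
open import Data.List using (List; []; _∷_; length; map; filter; concatMap; upTo; zip; foldr)
open import Data.Bool.ListAction using (and; all)
open import Data.Product using (_,_; proj₁; proj₂)
open import Data.Integer using (ℤ; +_; -_; _*_; _+_)
open import Relation.Nullary.Decidable using (Dec; yes; no)
open import Relation.Binary.PropositionalEquality using (_≡_)
open import Data.Bool using (T)
open import Relation.Nullary using (Dec)
import Data.Bool.Properties as BP

-- Permutations of length n are represented in one-line notation, 0-based:
-- a list [σ(0), …, σ(n-1)] which is a rearrangement of 0,…,n-1.

words : ℕ → ℕ → List (List ℕ)
words n zero    = [] ∷ []
words n (suc k) = concatMap (λ a → map (a ∷_) (words n k)) (upTo n)

distinct : List ℕ → Bool
distinct []       = true
distinct (a ∷ as) = all (λ b → not (a ≡ᵇ b)) as ∧ distinct as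

perms : ℕ → List (List ℕ)
perms n = filter (λ w → BP.T? (distinct w)) (words n n)

-- i-th entry (default 0 out of range)
at : List ℕ → ℕ → ℕ
at []       _       = 0
at (a ∷ as) zero    = a
at (a ∷ as) (suc i) = at as i

isInvolution : List ℕ → Bool
isInvolution σ = all (λ i → at σ (at σ i) ≡ᵇ i) (upTo (length σ))

subseqs : List ℕ → List (List ℕ)
subseqs []       = [] ∷ []
subseqs (a ∷ as) = let r = subseqs as in map (a ∷_) r Data.List.++ r

_==_ : Bool → Bool → Bool
true  == y = y
false == y = not y

sameOrder : List ℕ → List ℕ → Bool
sameOrder []       []       = true
sameOrder (a ∷ as) (b ∷ bs) =
  and (map (λ p → ((a <ᵇ proj₁ p) == (b <ᵇ proj₂ p)) ∧ ((proj₁ p <ᵇ a) == (proj₂ p <ᵇ b)))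
           (zip as bs))
  ∧ sameOrder as bs
sameOrder _ _ = false

count : {A : Set} → (A → Bool) → List A → ℕ
count p []       = 0
count p (x ∷ xs) = if p x then suc (count p xs) else count p xs

occurrences : List ℕ → List ℕ → ℕ
occurrences π σ = count (sameOrder π) (subseqs σ)

inversions : List ℕ → ℕ
inversions []       = 0
inversions (a ∷ as) = count (λ b → b <ᵇ a) as Data.Nat.+ inversions as

sign : List ℕ → ℤ
sign σ = parity (inversions σ)
  where
  parity : ℕ → ℤ
  parity zero          = + 1
  parity (suc zero)    = - (+ 1)
  parity (suc (suc k)) = parity k

inI3412 : List ℕ → List ℕ → Bool
inI3412 π σ = isInvolution σ ∧ (occurrences (2 ∷ 3 ∷ 0 ∷ 1 ∷ []) σ ≡ᵇ 0) ∧ (occurrences π σ ≡ᵇ 1)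

-- coefficient of x^n in G^+_π and G^-_π
Gplus : List ℕ → ℕ → ℤ
Gplus π n = + count (inI3412 π) (perms n)

Gminus : List ℕ → ℕ → ℤ
Gminus π n = sum′ (map sign (filter (λ σ → BP.T? (inI3412 π σ)) (perms n)))
  where
  sum′ : List ℤ → ℤ
  sum′ = foldr _+_ (+ 0)

-- formal power series as coefficient sequences; polynomials as coefficient lists
-- coefficient of x^n in Q(x) · A(x)
mulCoeff : List ℤ → (ℕ → ℤ) → ℕ → ℤ
mulCoeff []       a n       = + 0
mulCoeff (q ∷ qs) a zero    = q * a zero
mulCoeff (q ∷ qs) a (suc n) = q * a (suc n) + mulCoeff qs a n

polyCoeff : List ℤ → ℕ → ℤ
polyCoeff []       n       = + 0
polyCoeff (p ∷ ps) zero    = p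
polyCoeff (p ∷ ps) (suc n) = polyCoeff ps n

-- A(x) = P(x)/Q(x) as formal power series (Q has constant term 1, hence invertible):
-- equivalently Q(x)·A(x) = P(x) coefficientwise
IsQuotient : (ℕ → ℤ) → List ℤ → List ℤ → Set
IsQuotient a P Q = ∀ n → mulCoeff Q a n ≡ polyCoeff P n

-- patterns in 0-based one-line notation
p213 p132 : List ℕ
p213 = 1 ∷ 0 ∷ 2 ∷ []
p132 = 0 ∷ 2 ∷ 1 ∷ []

x³ : List ℤ
x³ = + 0 ∷ + 0 ∷ + 0 ∷ + 1 ∷ []

-x³ : List ℤ
-x³ = + 0 ∷ + 0 ∷ + 0 ∷ - (+ 1) ∷ []

1-x-x² 1-x+x² : List ℤ
1-x-x² = + 1 ∷ - (+ 1) ∷ - (+ 1) ∷ []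
1-x+x² = + 1 ∷ - (+ 1) ∷ + 1 ∷ []

-- An involution σ ∈ I(3412; 213) of length n+2 is pinned down by its first entry. If σ(1) = 1 then
-- σ = 1 ⊕ τ. If σ(1) = n+2 then σ(n+2) = 1 and σ = (n+2)(τ+1)1. Any other first entry forces σ = 213:
-- otherwise σ would contain a second 213 or a 3412. Both constructions preserve the involution property,
-- the avoidance of 3412 and the number of 213s, so a(n+2) = a(n+1) + a(n) + [n = 1]. The second one adds
-- 2n+1 inversions and so flips the sign, which gives s(n+2) = s(n+1) − s(n) − [n = 1]. Reading the last
-- entry instead, with τ ⊕ 1 in place of 1 ⊕ τ, gives the same recurrences for 132.

module Submission where

open import Data.Bool using (Bool; true; false; _∧_; not; T)
open import Data.Bool.ListAction using (and; all)
open import Data.Bool.Properties using (T?; T-∧; T-≡)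
open import Data.Empty using (⊥; ⊥-elim)
open import Data.Integer as ℤ using (ℤ)
import Data.Integer.Properties as ℤP
open import Data.Integer.Tactic.RingSolver using () renaming (solve-∀ to ℤsolve-∀)
open import Data.List using (List; []; _∷_; _++_; [_]; map; length; filter; drop; zip; upTo; concatMap; replicate; initLast; _∷ʳ′_; foldr)
open import Data.List.Membership.Propositional using (_∈_; find; lose)
open import Data.List.Membership.Propositional.Properties using (∈-++⁺ˡ; ∈-++⁺ʳ; ∈-++⁻; ∈-map⁺; ∈-map⁻; ∈-concatMap⁺; ∈-concatMap⁻; ∈-upTo⁺; ∈-upTo⁻; ∈-filter⁺; ∈-filter⁻)
open import Data.List.Membership.Propositional.Properties.WithK using (unique∧set⇒bag)
open import Data.List.Properties using (map-∘; map-++; length-map; length-++; ∷-injective; ≡-dec; map-injective; ∷ʳ-injectiveˡ; ∷ʳ-injectiveʳ; map-cong-local; ++-identityʳ)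
open import Data.List.Relation.Binary.BagAndSetEquality using (∼bag⇒↭)
open import Data.List.Relation.Binary.Permutation.Propositional using (_↭_; ↭⇒↭ₛ)
import Data.List.Relation.Binary.Permutation.Propositional.Properties as ↭
open import Data.List.Relation.Binary.Permutation.Setoid.Properties ℤP.≡-setoid using (foldr-commMonoid)
open import Data.List.Relation.Unary.All as All using (All; []; _∷_)
import Data.List.Relation.Unary.All.Properties as AllP
open import Data.List.Relation.Unary.AllPairs using ([]; _∷_)
open import Data.List.Relation.Unary.Any using (here; there)
open import Data.List.Relation.Unary.Unique.Propositional using (Unique)
import Data.List.Relation.Unary.Unique.Propositional.Properties as UP
open import Data.Nat using (ℕ; zero; suc; _+_; _<_; _≤_; _<ᵇ_; _≡ᵇ_; z≤n; s≤s; z<s; s<s)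
open import Data.Nat.Properties
open import Data.Nat.Tactic.RingSolver using (solve-∀)
open import Data.Product using (_×_; _,_; proj₁; proj₂; Σ-syntax)
open import Data.Sum using (inj₁; inj₂)
open import Data.Unit using (tt)
open import Function using (_∘_; case_of_)
open import Function.Bundles using (Equivalence; _⇔_; mk⇔)
open import Relation.Binary.Definitions using (tri<; tri≈; tri>)
open import Relation.Binary.PropositionalEquality hiding ([_])
open import Relation.Nullary using (¬_; yes; no)

open import Defs

∧-fst : ∀ {x y} → T (x ∧ y) → T x
∧-fst h = proj₁ (Equivalence.to T-∧ h)

∧-snd : ∀ {x y} → T (x ∧ y) → T y
∧-snd h = proj₂ (Equivalence.to T-∧ h)

∧-intro : ∀ {x y} → T x → T y → T (x ∧ y)
∧-intro p q = Equivalence.from T-∧ (p , q)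

T-not⇒¬T : ∀ {x} → T (not x) → ¬ T x
T-not⇒¬T {false} _ ()

¬T⇒T-not : ∀ {x} → ¬ T x → T (not x)
¬T⇒T-not {false} _  = _
¬T⇒T-not {true}  ¬x = ¬x _

<ᵇ-true : ∀ {m n} → m < n → (m <ᵇ n) ≡ true
<ᵇ-true m<n = Equivalence.to T-≡ (<⇒<ᵇ m<n)

<ᵇ-false : ∀ {m n} → n ≤ m → (m <ᵇ n) ≡ false
<ᵇ-false {m} {n} n≤m with m <ᵇ n in eq
... | false = refl
... | true  = ⊥-elim (<⇒≱ (<ᵇ⇒< m n (Equivalence.from T-≡ eq)) n≤m)

T-injective : ∀ {x y} → (T x → T y) → (T y → T x) → x ≡ y
T-injective {false} {false} _ _ = refl
T-injective {false} {true}  _ g = ⊥-elim (g _)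
T-injective {true}  {false} f _ = ⊥-elim (f _)
T-injective {true}  {true}  _ _ = refl

≡<≡ : ∀ {a b x y} → a ≡ x → b ≡ y → x < y → a < b
≡<≡ refl refl x<y = x<y

<2+n∧≢⇒< : ∀ {x n} → x < suc (suc n) → x ≢ n → x ≢ suc n → x < n
<2+n∧≢⇒< x<2+n x≢n x≢1+n with m<1+n⇒m<n∨m≡n x<2+n
... | inj₂ x≡1+n = ⊥-elim (x≢1+n x≡1+n)
... | inj₁ x<1+n with m<1+n⇒m<n∨m≡n x<1+n
...   | inj₂ x≡n = ⊥-elim (x≢n x≡n)
...   | inj₁ x<n = x<n

1<n : ∀ {n} → n ≢ 0 → n ≢ 1 → 1 < n
1<n {zero}          n≢0 _   = ⊥-elim (n≢0 refl)
1<n {suc zero}      _   n≢1 = ⊥-elim (n≢1 refl)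
1<n {suc (suc n)}   _   _   = s<s z<s

<-≢-pred : ∀ {x m} → x < suc m → x ≢ m → x < m
<-≢-pred x< x≢m = ≤∧≢⇒< (≤-pred x<) x≢m

at-++ˡ : ∀ xs ys {i} → i < length xs → at (xs ++ ys) i ≡ at xs i
at-++ˡ (x ∷ xs) ys {zero}  _        = refl
at-++ˡ (x ∷ xs) ys {suc i} (s≤s i<) = at-++ˡ xs ys i<

at-length : ∀ xs y ys → at (xs ++ y ∷ ys) (length xs) ≡ y
at-length []       y ys = refl
at-length (x ∷ xs) y ys = at-length xs y ys

at-map : ∀ (f : ℕ → ℕ) xs {i} → i < length xs → at (map f xs) i ≡ f (at xs i)
at-map f (x ∷ xs) {zero}  _        = refl
at-map f (x ∷ xs) {suc i} (s≤s i<) = at-map f xs i<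

at∈ : ∀ xs {i} → i < length xs → at xs i ∈ xs
at∈ (x ∷ xs) {zero}  _        = here refl
at∈ (x ∷ xs) {suc i} (s≤s i<) = there (at∈ xs i<)

at-All : ∀ {P : ℕ → Set} {xs i} → All P xs → i < length xs → P (at xs i)
at-All {xs = xs} pxs i< = All.lookup pxs (at∈ xs i<)

length-∷ʳ : ∀ (xs : List ℕ) x → length (xs ++ [ x ]) ≡ suc (length xs)
length-∷ʳ xs x = trans (length-++ xs) (+-comm (length xs) 1)

∷ʳ-view : ∀ (xs : List ℕ) → xs ≢ [] → Σ[ ys ∈ List ℕ ] Σ[ y ∈ ℕ ] xs ≡ ys ++ [ y ]
∷ʳ-view xs xs≢[] with initLast xs
... | []       = ⊥-elim (xs≢[] refl)
... | ys ∷ʳ′ y = ys , y , refl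

Unique-∷ʳ⁻ : ∀ (xs : List ℕ) {y} → Unique (xs ++ [ y ]) → All (_≢ y) xs × Unique xs
Unique-∷ʳ⁻ []       _          = [] , []
Unique-∷ʳ⁻ (x ∷ xs) (x∉ ∷ xs!) =
  let xs≢y , xs!′ = Unique-∷ʳ⁻ xs xs! in All.lookup x∉ (∈-++⁺ʳ xs (here refl)) ∷ xs≢y , AllP.++⁻ˡ xs x∉ ∷ xs!′

map-suc-bounded : ∀ {n τ} → All (_< n) τ → All (_< suc n) (map suc τ)
map-suc-bounded τ<n = AllP.map⁺ (All.map s<s τ<n)

map-suc-nonzero : ∀ τ → All (0 ≢_) (map suc τ)
map-suc-nonzero τ = AllP.map⁺ (All.universal (λ _ ()) τ)

map-suc-view : ∀ {M} xs → All (_< suc M) xs → All (0 ≢_) xs → Σ[ τ ∈ List ℕ ] map suc τ ≡ xs × All (_< M) τ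
map-suc-view []           _            _          = [] , refl , []
map-suc-view (zero ∷ xs)  _            (0≢0 ∷ _) = ⊥-elim (0≢0 refl)
map-suc-view (suc x ∷ xs) (s<s x< ∷ xs<) (_ ∷ xs≢0) =
  let τ , e , τ< = map-suc-view xs xs< xs≢0 in x ∷ τ , cong (suc x ∷_) e , x< ∷ τ<

length3 : ∀ σ → length σ ≡ 3 → σ ≡ at σ 0 ∷ at σ 1 ∷ at σ 2 ∷ []
length3 (a ∷ b ∷ c ∷ []) _ = refl

module _ {A : Set} (p : A → Bool) where

  count-++ : ∀ xs ys → count p (xs ++ ys) ≡ count p xs + count p ys
  count-++ []       ys = refl
  count-++ (x ∷ xs) ys with p x
  ... | true  = cong suc (count-++ xs ys)
  ... | false = count-++ xs ys

  count-≡0 : ∀ {xs} → All (¬_ ∘ T ∘ p) xs → count p xs ≡ 0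
  count-≡0 []                = refl
  count-≡0 {x ∷ _} (¬px ∷ h) with p x
  ... | true  = ⊥-elim (¬px _)
  ... | false = count-≡0 h

  count-≡length : ∀ {xs} → All (T ∘ p) xs → count p xs ≡ length xs
  count-≡length []               = refl
  count-≡length {x ∷ _} (px ∷ h) with p x
  ... | true = cong suc (count-≡length h)

  1≤count : ∀ {xs x} → x ∈ xs → T (p x) → 1 ≤ count p xs
  1≤count {y ∷ _} (here refl) px with p y
  ... | true = s≤s z≤n
  1≤count {y ∷ _} (there x∈) px with p y
  ... | true  = s≤s z≤n
  ... | false = 1≤count x∈ px

  2≤count : ∀ {xs x y} → x ∈ xs → y ∈ xs → x ≢ y → T (p x) → T (p y) → 2 ≤ count p xs
  2≤count (here refl) (here refl) x≢y _ _ = ⊥-elim (x≢y refl)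
  2≤count {z ∷ _} (here refl) (there y∈) _ px py with p z
  ... | true = s≤s (1≤count y∈ py)
  2≤count {z ∷ _} (there x∈) (here refl) _ px py with p z
  ... | true = s≤s (1≤count x∈ px)
  2≤count {z ∷ _} (there x∈) (there y∈) x≢y px py with p z
  ... | true  = m≤n⇒m≤1+n (2≤count x∈ y∈ x≢y px py)
  ... | false = 2≤count x∈ y∈ x≢y px py

  count≡length-filter : ∀ xs → count p xs ≡ length (filter (T? ∘ p) xs)
  count≡length-filter []       = refl
  count≡length-filter (x ∷ xs) with p x
  ... | true  = cong suc (count≡length-filter xs)
  ... | false = count≡length-filter xs

count-map : ∀ {A B : Set} (p : B → Bool) (f : A → B) xs → count p (map f xs) ≡ count (p ∘ f) xs
count-map p f []       = refl
count-map p f (x ∷ xs) with p (f x)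
... | true  = cong suc (count-map p f xs)
... | false = count-map p f xs

count-cong : ∀ {A : Set} {p q : A → Bool} xs → All (λ x → p x ≡ q x) xs → count p xs ≡ count q xs
count-cong [] [] = refl
count-cong {p = p} {q} (x ∷ xs) (e ∷ h) with p x | q x | e
... | true  | true  | _ = cong suc (count-cong xs h)
... | false | false | _ = count-cong xs h

subseqs-map : ∀ (f : ℕ → ℕ) xs → subseqs (map f xs) ≡ map (map f) (subseqs xs)
subseqs-map f []       = refl
subseqs-map f (x ∷ xs) = begin
  map (f x ∷_) (subseqs (map f xs)) ++ subseqs (map f xs)
    ≡⟨ cong (λ ss → map (f x ∷_) ss ++ ss) (subseqs-map f xs) ⟩
  map (f x ∷_) (map (map f) (subseqs xs)) ++ map (map f) (subseqs xs)
    ≡⟨ cong (_++ map (map f) (subseqs xs)) (trans (sym (map-∘ (subseqs xs))) (map-∘ (subseqs xs))) ⟩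
  map (map f) (map (x ∷_) (subseqs xs)) ++ map (map f) (subseqs xs)
    ≡⟨ map-++ (map f) (map (x ∷_) (subseqs xs)) (subseqs xs) ⟨
  map (map f) (subseqs (x ∷ xs)) ∎
  where open ≡-Reasoning

[]∈subseqs : ∀ xs → [] ∈ subseqs xs
[]∈subseqs []       = here refl
[]∈subseqs (x ∷ xs) = ∈-++⁺ʳ (map (x ∷_) (subseqs xs)) ([]∈subseqs xs)

All-subseqs : ∀ {P : ℕ → Set} {xs s} → All P xs → s ∈ subseqs xs → All P s
All-subseqs {xs = []}     []         (here refl) = []
All-subseqs {xs = x ∷ xs} (px ∷ pxs) s∈ with ∈-++⁻ (map (x ∷_) (subseqs xs)) s∈
... | inj₂ s∈′ = All-subseqs pxs s∈′
... | inj₁ s∈′ with ∈-map⁻ (x ∷_) s∈′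
...   | s′ , s′∈ , refl = px ∷ All-subseqs pxs s′∈

at∷∈subseqs : ∀ {d i} σ {s} → d ≤ i → i < length σ → s ∈ subseqs (drop (suc i) σ) →
              (at σ i ∷ s) ∈ subseqs (drop d σ)
at∷∈subseqs {zero}  {zero}  (a ∷ σ) _         _         s∈ = ∈-++⁺ˡ (∈-map⁺ (a ∷_) s∈)
at∷∈subseqs {zero}  {suc i} (a ∷ σ) _         (s≤s i<) s∈ =
  ∈-++⁺ʳ (map (a ∷_) (subseqs σ)) (at∷∈subseqs σ z≤n i< s∈)
at∷∈subseqs {suc d} {suc i} (a ∷ σ) (s≤s d≤) (s≤s i<) s∈ = at∷∈subseqs σ d≤ i< s∈

triple∈subseqs : ∀ σ {i j l} → i < j → j < l → l < length σ →
                 (at σ i ∷ at σ j ∷ at σ l ∷ []) ∈ subseqs σ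
triple∈subseqs σ {i} {j} {l} i<j j<l l<n =
  at∷∈subseqs σ z≤n (<-trans i<j (<-trans j<l l<n))
    (at∷∈subseqs σ i<j (<-trans j<l l<n)
      (at∷∈subseqs σ j<l l<n ([]∈subseqs (drop (suc l) σ))))

quadruple∈subseqs : ∀ σ {i j l m} → i < j → j < l → l < m → m < length σ →
                    (at σ i ∷ at σ j ∷ at σ l ∷ at σ m ∷ []) ∈ subseqs σ
quadruple∈subseqs σ {i} {j} {l} {m} i<j j<l l<m m<n =
  at∷∈subseqs σ z≤n (<-trans i<j (<-trans j<l (<-trans l<m m<n)))
    (at∷∈subseqs σ i<j (<-trans j<l (<-trans l<m m<n))
      (at∷∈subseqs σ j<l (<-trans l<m m<n)
        (at∷∈subseqs σ l<m m<n ([]∈subseqs (drop (suc m) σ)))))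

count-subseqs-∷ : ∀ (p : List ℕ → Bool) a xs →
  count p (subseqs (a ∷ xs)) ≡ count (p ∘ (a ∷_)) (subseqs xs) + count p (subseqs xs)
count-subseqs-∷ p a xs rewrite count-++ p (map (a ∷_) (subseqs xs)) (subseqs xs)
  | count-map p (a ∷_) (subseqs xs) = refl

count-subseqs-∷ʳ : ∀ (p : List ℕ → Bool) xs y →
  count p (subseqs (xs ++ [ y ])) ≡ count (p ∘ (_++ [ y ])) (subseqs xs) + count p (subseqs xs)
count-subseqs-∷ʳ p []       y with p (y ∷ []) | p []
... | true  | _ = refl
... | false | _ = refl
count-subseqs-∷ʳ p (a ∷ xs) y = begin
  count p (subseqs (a ∷ xs ++ [ y ]))
    ≡⟨ count-subseqs-∷ p a (xs ++ [ y ]) ⟩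
  count (p ∘ (a ∷_)) (subseqs (xs ++ [ y ])) + count p (subseqs (xs ++ [ y ]))
    ≡⟨ cong₂ _+_ (count-subseqs-∷ʳ (p ∘ (a ∷_)) xs y) (count-subseqs-∷ʳ p xs y) ⟩
  (w + x) + (y′ + z)
    ≡⟨ interchange w x y′ z ⟩
  (w + y′) + (x + z)
    ≡⟨ cong₂ _+_ (sym (count-subseqs-∷ (p ∘ (_++ [ y ])) a xs)) (sym (count-subseqs-∷ p a xs)) ⟩
  count (p ∘ (_++ [ y ])) (subseqs (a ∷ xs)) + count p (subseqs (a ∷ xs)) ∎
  where
  open ≡-Reasoning
  w  = count (λ s → p (a ∷ s ++ [ y ])) (subseqs xs)
  x  = count (λ s → p (a ∷ s)) (subseqs xs)
  y′ = count (λ s → p (s ++ [ y ])) (subseqs xs)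
  z  = count p (subseqs xs)
  interchange : ∀ w x y z → (w + x) + (y + z) ≡ (w + y) + (x + z)
  interchange = solve-∀

-- Patterns

p3412 : List ℕ
p3412 = 2 ∷ 3 ∷ 0 ∷ 1 ∷ []

agrees : ℕ → ℕ → ℕ → ℕ → Bool
agrees p a q b = ((p <ᵇ q) == (a <ᵇ b)) ∧ ((q <ᵇ p) == (b <ᵇ a))

headAgrees : ℕ → ℕ → List ℕ → List ℕ → Bool
headAgrees a b as bs = and (map (λ xy → agrees a b (proj₁ xy) (proj₂ xy)) (zip as bs))

sameOrder-∷⁻ : ∀ a as b bs → T (sameOrder (a ∷ as) (b ∷ bs)) → T (headAgrees a b as bs) × T (sameOrder as bs)
sameOrder-∷⁻ a as b bs = Equivalence.to (T-∧ {headAgrees a b as bs})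

sameOrder-length : ∀ π t → T (sameOrder π t) → length π ≡ length t
sameOrder-length []      []      _ = refl
sameOrder-length (a ∷ π) (b ∷ t) h = cong suc (sameOrder-length π t (proj₂ (sameOrder-∷⁻ a π b t h)))

headAgrees⇒agrees : ∀ {a b} as bs → T (headAgrees a b as bs) → T (sameOrder as bs) →
                    ∀ {k} → k < length as → T (agrees a b (at as k) (at bs k))
headAgrees⇒agrees {a} {b} (x ∷ as) (y ∷ bs) h _ {zero}  _        = ∧-fst {agrees a b x y} h
headAgrees⇒agrees {a} {b} (x ∷ as) (y ∷ bs) h s {suc k} (s≤s k<) =
  headAgrees⇒agrees as bs (∧-snd {agrees a b x y} h) (proj₂ (sameOrder-∷⁻ x as y bs s)) k<

sameOrder⇒agrees : ∀ π t → T (sameOrder π t) → ∀ {i j} → i < j → j < length π →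
                   T (agrees (at π i) (at t i) (at π j) (at t j))
sameOrder⇒agrees (a ∷ π) (b ∷ t) h {zero}  {suc j} _          (s≤s j<) =
  headAgrees⇒agrees π t (proj₁ (sameOrder-∷⁻ a π b t h)) (proj₂ (sameOrder-∷⁻ a π b t h)) j<
sameOrder⇒agrees (a ∷ π) (b ∷ t) h {suc i} {suc j} (s≤s i<j) (s≤s j<) =
  sameOrder⇒agrees π t (proj₂ (sameOrder-∷⁻ a π b t h)) i<j j<

agrees-< : ∀ {p a q b} → T (agrees p a q b) → p < q → a < b
agrees-< {p} {a} {q} {b} h p<q rewrite <ᵇ-true p<q = <ᵇ⇒< a b (∧-fst {a <ᵇ b} h)

agrees-> : ∀ {p a q b} → T (agrees p a q b) → q < p → b < a
agrees-> {p} {a} {q} {b} h q<p rewrite <ᵇ-true q<p = <ᵇ⇒< b a (∧-snd {(p <ᵇ q) == (a <ᵇ b)} h)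

sameOrder⇒< : ∀ π t → T (sameOrder π t) → ∀ {i j} → i < length π → j < length π →
              at π i < at π j → at t i < at t j
sameOrder⇒< π t h {i} {j} i< j< πi<πj with <-cmp i j
... | tri< i<j _ _ = agrees-< (sameOrder⇒agrees π t h i<j j<) πi<πj
... | tri≈ _ refl _ = ⊥-elim (<-irrefl refl πi<πj)
... | tri> _ _ j<i = agrees-> (sameOrder⇒agrees π t h j<i i<) πi<πj

headAgrees-map-suc : ∀ a b as bs → headAgrees a (suc b) as (map suc bs) ≡ headAgrees a b as bs
headAgrees-map-suc a b []       bs       = refl
headAgrees-map-suc a b (x ∷ as) []       = refl
headAgrees-map-suc a b (x ∷ as) (y ∷ bs) = cong (agrees a b x y ∧_) (headAgrees-map-suc a b as bs)

sameOrder-map-suc : ∀ π t → sameOrder π (map suc t) ≡ sameOrder π t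
sameOrder-map-suc []      []      = refl
sameOrder-map-suc []      (_ ∷ _) = refl
sameOrder-map-suc (_ ∷ _) []      = refl
sameOrder-map-suc (a ∷ π) (b ∷ t) = cong₂ _∧_ (headAgrees-map-suc a b π t) (sameOrder-map-suc π t)

occurrences-map-suc : ∀ π xs → occurrences π (map suc xs) ≡ occurrences π xs
occurrences-map-suc π xs = begin
  count (sameOrder π) (subseqs (map suc xs))          ≡⟨ cong (count (sameOrder π)) (subseqs-map suc xs) ⟩
  count (sameOrder π) (map (map suc) (subseqs xs))    ≡⟨ count-map (sameOrder π) (map suc) (subseqs xs) ⟩
  count (sameOrder π ∘ map suc) (subseqs xs)          ≡⟨ count-cong (subseqs xs) (All.universal (sameOrder-map-suc π) _) ⟩
  count (sameOrder π) (subseqs xs)                    ∎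
  where open ≡-Reasoning

module _ (π : List ℕ) {j : ℕ} (j< : j < length π) where

  ¬sameOrder-0∷ : at π j < at π 0 → ∀ s → ¬ T (sameOrder π (0 ∷ s))
  ¬sameOrder-0∷ πj<π0 s h = n≮0 (sameOrder⇒< π (0 ∷ s) h j< (≤-<-trans z≤n j<) πj<π0)

  ¬sameOrder-max∷ : at π 0 < at π j → ∀ {M} s → All (_< M) s → ¬ T (sameOrder π (M ∷ s))
  ¬sameOrder-max∷ π0<πj {M} s s<M h = <⇒≱ M<tj (at-All (≤-refl ∷ All.map <⇒≤ s<M) (subst (j <_) len j<))
    where
    len = sameOrder-length π (M ∷ s) h
    M<tj = sameOrder⇒< π (M ∷ s) h (≤-<-trans z≤n j<) j< π0<πj

  module _ {ℓ : ℕ} (ℓ< : suc ℓ ≡ length π) where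

    private
      ending : ∀ s y → T (sameOrder π (s ++ [ y ])) → at (s ++ [ y ]) ℓ ≡ y
      ending s y h = trans (cong (at (s ++ [ y ])) ℓ≡) (at-length s y [])
        where
        ℓ≡ : ℓ ≡ length s
        ℓ≡ = suc-injective (trans ℓ< (trans (sameOrder-length π (s ++ [ y ]) h) (length-∷ʳ s y)))

    ¬sameOrder-∷ʳ0 : at π j < at π ℓ → ∀ s → ¬ T (sameOrder π (s ++ [ 0 ]))
    ¬sameOrder-∷ʳ0 πj<πℓ s h =
      n≮0 (subst (at (s ++ [ 0 ]) j <_) (ending s 0 h) (sameOrder⇒< π _ h j< (subst (ℓ <_) ℓ< ≤-refl) πj<πℓ))

    ¬sameOrder-∷ʳmax : at π ℓ < at π j → ∀ {M} s → All (_< M) s → ¬ T (sameOrder π (s ++ [ M ]))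
    ¬sameOrder-∷ʳmax πℓ<πj {M} s s<M h =
      <⇒≱ M<tj (at-All (AllP.++⁺ (All.map <⇒≤ s<M) (≤-refl ∷ [])) (subst (j <_) len j<))
      where
      len = sameOrder-length π (s ++ [ M ]) h
      M<tj : M < at (s ++ [ M ]) j
      M<tj = subst (_< at (s ++ [ M ]) j) (ending s M h) (sameOrder⇒< π _ h (subst (ℓ <_) ℓ< ≤-refl) j< πℓ<πj)

213-occurrence : ∀ {a b c} → b < a → a < c → T (sameOrder p213 (a ∷ b ∷ c ∷ []))
213-occurrence b<a a<c
  rewrite <ᵇ-true b<a | <ᵇ-false (<⇒≤ b<a) | <ᵇ-true a<c | <ᵇ-false (<⇒≤ a<c)
        | <ᵇ-true (<-trans b<a a<c) | <ᵇ-false (<⇒≤ (<-trans b<a a<c)) = _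

132-occurrence : ∀ {a b c} → a < c → c < b → T (sameOrder p132 (a ∷ b ∷ c ∷ []))
132-occurrence a<c c<b
  rewrite <ᵇ-true a<c | <ᵇ-false (<⇒≤ a<c) | <ᵇ-true c<b | <ᵇ-false (<⇒≤ c<b)
        | <ᵇ-true (<-trans a<c c<b) | <ᵇ-false (<⇒≤ (<-trans a<c c<b)) = _

3412-occurrence : ∀ {a b c d} → c < d → d < a → a < b → T (sameOrder p3412 (a ∷ b ∷ c ∷ d ∷ []))
3412-occurrence c<d d<a a<b
  rewrite <ᵇ-true c<d | <ᵇ-false (<⇒≤ c<d) | <ᵇ-true d<a | <ᵇ-false (<⇒≤ d<a)
        | <ᵇ-true a<b | <ᵇ-false (<⇒≤ a<b)
        | <ᵇ-true (<-trans c<d d<a) | <ᵇ-false (<⇒≤ (<-trans c<d d<a))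
        | <ᵇ-true (<-trans d<a a<b) | <ᵇ-false (<⇒≤ (<-trans d<a a<b))
        | <ᵇ-true (<-trans (<-trans c<d d<a) a<b) | <ᵇ-false (<⇒≤ (<-trans (<-trans c<d d<a) a<b)) = _

-- Permutations

record IsPerm (n : ℕ) (σ : List ℕ) : Set where
  field
    length≡ : length σ ≡ n
    bounded : All (_< n) σ
    unique  : Unique σ

distinct⇒Unique : ∀ σ → T (distinct σ) → Unique σ
distinct⇒Unique []       _ = []
distinct⇒Unique (a ∷ as) h =
  All.map (λ {b} a≢ᵇb a≡b → T-not⇒¬T a≢ᵇb (≡⇒≡ᵇ a b a≡b))
    (AllP.all⁺ (λ b → not (a ≡ᵇ b)) as (∧-fst {all (λ b → not (a ≡ᵇ b)) as} h))
  ∷ distinct⇒Unique as (∧-snd {all (λ b → not (a ≡ᵇ b)) as} h)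

Unique⇒distinct : ∀ σ → Unique σ → T (distinct σ)
Unique⇒distinct []       []         = _
Unique⇒distinct (a ∷ as) (a∉ ∷ as!) =
  ∧-intro (AllP.all⁻ (λ b → not (a ≡ᵇ b)) (All.map (λ {b} a≢b → ¬T⇒T-not (a≢b ∘ ≡ᵇ⇒≡ a b)) a∉))
          (Unique⇒distinct as as!)

words⁻ : ∀ {n} k {σ} → σ ∈ words n k → length σ ≡ k × All (_< n) σ
words⁻ zero    (here refl) = refl , []
words⁻ {n} (suc k) σ∈ with find (∈-concatMap⁻ (λ a → map (a ∷_) (words n k)) {xs = upTo n} σ∈)
... | a , a∈ , σ∈′ with ∈-map⁻ (a ∷_) σ∈′
...   | τ , τ∈ , refl with words⁻ k τ∈
...     | len , bnd = cong suc len , ∈-upTo⁻ a∈ ∷ bnd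

words⁺ : ∀ {n} k {σ} → length σ ≡ k → All (_< n) σ → σ ∈ words n k
words⁺ zero    {[]}    refl []          = here refl
words⁺ {n} (suc k) {a ∷ σ} len (a< ∷ bnd) =
  ∈-concatMap⁺ (λ b → map (b ∷_) (words n k))
    (lose (∈-upTo⁺ a<) (∈-map⁺ (a ∷_) (words⁺ k (suc-injective len) bnd)))

words-unique : ∀ n k → Unique (words n k)
words-unique n zero    = [] ∷ []
words-unique n (suc k) = prefixAll (upTo n) (UP.upTo⁺ n)
  where
  W = words n k
  prefixAll : ∀ as → Unique as → Unique (concatMap (λ a → map (a ∷_) W) as)
  prefixAll []       _           = []
  prefixAll (a ∷ as) (a∉ ∷ as!) =
    UP.++⁺ (UP.map⁺ (λ e → proj₂ (∷-injective e)) (words-unique n k)) (prefixAll as as!) disjoint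
    where
    disjoint : ∀ {v} → ¬ (v ∈ map (a ∷_) W × v ∈ concatMap (λ b → map (b ∷_) W) as)
    disjoint (v∈₁ , v∈₂) with ∈-map⁻ (a ∷_) v∈₁ | find (∈-concatMap⁻ (λ b → map (b ∷_) W) {xs = as} v∈₂)
    ... | _ , _ , refl | b , b∈ , v∈′ with ∈-map⁻ (b ∷_) v∈′
    ...   | _ , _ , e = All.lookup a∉ b∈ (proj₁ (∷-injective e))

perms⁻ : ∀ {n σ} → σ ∈ perms n → IsPerm n σ
perms⁻ {n} {σ} σ∈ with ∈-filter⁻ (T? ∘ distinct) {xs = words n n} σ∈
... | w∈ , d = record { length≡ = proj₁ (words⁻ n w∈) ; bounded = proj₂ (words⁻ n w∈) ; unique = distinct⇒Unique σ d }

perms⁺ : ∀ {n σ} → IsPerm n σ → σ ∈ perms n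
perms⁺ {n} {σ} p = ∈-filter⁺ (T? ∘ distinct) (words⁺ n length≡ bounded) (Unique⇒distinct σ unique)
  where open IsPerm p

perms-unique : ∀ n → Unique (perms n)
perms-unique n = UP.filter⁺ (T? ∘ distinct) (words-unique n n)

bounded-by-length : ∀ {n σ} → IsPerm n σ → All (_< length σ) σ
bounded-by-length {σ = σ} p = subst (λ k → All (_< k) σ) (sym (IsPerm.length≡ p)) (IsPerm.bounded p)

-- Involutions

Involutive : List ℕ → Set
Involutive σ = ∀ {i} → i < length σ → at σ (at σ i) ≡ i

isInvolution⇒Involutive : ∀ σ → T (isInvolution σ) → Involutive σ
isInvolution⇒Involutive σ h i< =
  ≡ᵇ⇒≡ _ _ (All.lookup (AllP.all⁺ _ (upTo (length σ)) h) (∈-upTo⁺ i<))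

Involutive⇒isInvolution : ∀ σ → Involutive σ → T (isInvolution σ)
Involutive⇒isInvolution σ inv = AllP.all⁻ _ (All.tabulate (λ i∈ → ≡⇒≡ᵇ _ _ (inv (∈-upTo⁻ i∈))))

isInvolution-cong : ∀ σ τ → (Involutive σ ⇔ Involutive τ) → isInvolution σ ≡ isInvolution τ
isInvolution-cong σ τ σ⇔τ = T-injective
  (Involutive⇒isInvolution τ ∘ Equivalence.to σ⇔τ ∘ isInvolution⇒Involutive σ)
  (Involutive⇒isInvolution σ ∘ Equivalence.from σ⇔τ ∘ isInvolution⇒Involutive τ)

record InI3412 (π σ : List ℕ) : Set where
  field
    involutive   : Involutive σ
    avoids3412   : occurrences p3412 σ ≡ 0
    containsOnce : occurrences π σ ≡ 1

inI3412⇒InI3412 : ∀ π σ → T (inI3412 π σ) → InI3412 π σ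
inI3412⇒InI3412 π σ h = record
  { involutive   = isInvolution⇒Involutive σ (∧-fst {isInvolution σ} h)
  ; avoids3412   = ≡ᵇ⇒≡ _ 0 (∧-fst {occurrences p3412 σ ≡ᵇ 0} (∧-snd {isInvolution σ} h))
  ; containsOnce = ≡ᵇ⇒≡ _ 1 (∧-snd {occurrences p3412 σ ≡ᵇ 0} (∧-snd {isInvolution σ} h))
  }

inI3412-cong : ∀ π σ τ → (Involutive σ ⇔ Involutive τ) → occurrences p3412 σ ≡ occurrences p3412 τ →
               occurrences π σ ≡ occurrences π τ → inI3412 π σ ≡ inI3412 π τ
inI3412-cong π σ τ σ⇔τ e₁ e₂ rewrite isInvolution-cong σ τ σ⇔τ | e₁ | e₂ = refl

module _ {σ : List ℕ} (inv : Involutive σ) where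

  at-injective : ∀ {i j} → i < length σ → j < length σ → at σ i ≡ at σ j → i ≡ j
  at-injective i< j< e = trans (sym (inv i<)) (trans (cong (at σ) e) (inv j<))

  occursOnce⇒sameIndices : ∀ {π} → occurrences π σ ≡ 1 →
    ∀ {i j l i′ j′ l′} → i < j → j < l → l < length σ → i′ < j′ → j′ < l′ → l′ < length σ →
    T (sameOrder π (at σ i ∷ at σ j ∷ at σ l ∷ [])) → T (sameOrder π (at σ i′ ∷ at σ j′ ∷ at σ l′ ∷ [])) →
    i ≡ i′ × j ≡ j′ × l ≡ l′
  occursOnce⇒sameIndices {π} once {i} {j} {l} {i′} {j′} {l′} i<j j<l l< i′<j′ j′<l′ l′< occ occ′
    with ≡-dec _≟_ (at σ i ∷ at σ j ∷ at σ l ∷ []) (at σ i′ ∷ at σ j′ ∷ at σ l′ ∷ [])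
  ... | no differ = ⊥-elim (<-irrefl refl (subst (2 ≤_) once
          (2≤count (sameOrder π) (triple∈subseqs σ i<j j<l l<) (triple∈subseqs σ i′<j′ j′<l′ l′<) differ occ occ′)))
  ... | yes same with ∷-injective same
  ...   | ei , same′ with ∷-injective same′
  ...     | ej , same″ = at-injective (<-trans i<j j<<) (<-trans i′<j′ j′<<) ei
                       , at-injective j<< j′<< ej
                       , at-injective l< l′< (proj₁ (∷-injective same″))
    where
    j<< = <-trans j<l l<
    j′<< = <-trans j′<l′ l′<

avoids3412⇒noIndices : ∀ σ → occurrences p3412 σ ≡ 0 →
  ∀ {i j l m} → i < j → j < l → l < m → m < length σ →
  at σ l < at σ m → at σ m < at σ i → at σ i < at σ j → ⊥
avoids3412⇒noIndices σ none i<j j<l l<m m< c<d d<a a<b =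
  n≮0 (subst (1 ≤_) none (1≤count (sameOrder p3412) (quadruple∈subseqs σ i<j j<l l<m m<) (3412-occurrence c<d d<a a<b)))

-- Three ways of enlarging an involution

-- In the paper's 1-based notation, for τ of length n: 1 ⊕ τ, τ ⊕ 1, and (n+2)(τ+1)1.
fixFirst : List ℕ → List ℕ
fixFirst τ = 0 ∷ map suc τ

fixLast : List ℕ → List ℕ
fixLast τ = τ ++ [ length τ ]

wrap : List ℕ → List ℕ
wrap τ = suc (length τ) ∷ map suc τ ++ [ 0 ]

length-fixFirst : ∀ τ → length (fixFirst τ) ≡ suc (length τ)
length-fixFirst τ = cong suc (length-map suc τ)

length-wrap : ∀ τ → length (wrap τ) ≡ suc (suc (length τ))
length-wrap τ = cong suc (trans (length-∷ʳ (map suc τ) 0) (cong suc (length-map suc τ)))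

IsPerm-fixFirst : ∀ {n τ} → IsPerm n τ → IsPerm (suc n) (fixFirst τ)
IsPerm-fixFirst {n} {τ} p = record
  { length≡ = trans (length-fixFirst τ) (cong suc length≡)
  ; bounded = z<s ∷ map-suc-bounded bounded
  ; unique  = map-suc-nonzero τ ∷ UP.map⁺ suc-injective unique
  }
  where open IsPerm p

IsPerm-fixLast : ∀ {n τ} → IsPerm n τ → IsPerm (suc n) (fixLast τ)
IsPerm-fixLast {n} {τ} p = record
  { length≡ = trans (length-∷ʳ τ (length τ)) (cong suc length≡)
  ; bounded = AllP.++⁺ (All.map m<n⇒m<1+n bounded) (subst (_< suc n) (sym length≡) ≤-refl ∷ [])
  ; unique  = UP.++⁺ unique ([] ∷ []) λ { (x∈ , here refl) → <-irrefl length≡ (All.lookup bounded x∈) }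
  }
  where open IsPerm p

IsPerm-wrap : ∀ {n τ} → IsPerm n τ → IsPerm (suc (suc n)) (wrap τ)
IsPerm-wrap {n} {τ} p = record
  { length≡ = trans (length-wrap τ) (cong (suc ∘ suc) length≡)
  ; bounded = s<s (subst (_< suc n) (sym length≡) ≤-refl) ∷ All.map m<n⇒m<1+n middle<
  ; unique  = All.map (λ x< e → <-irrefl (trans (sym e) (cong suc length≡)) x<) middle<
            ∷ UP.++⁺ (UP.map⁺ suc-injective unique) ([] ∷ [])
                (λ { (x∈ , here refl) → All.lookup (map-suc-nonzero τ) x∈ refl })
  }
  where
  open IsPerm p
  middle< : All (_< suc n) (map suc τ ++ [ 0 ])
  middle< = AllP.++⁺ (map-suc-bounded bounded) (z<s ∷ [])

module _ {τ : List ℕ} (bnd : All (_< length τ) τ) where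

  private
    at< : ∀ {i} → i < length τ → at τ i < length τ
    at< = at-All bnd

    <length-map : ∀ {i} → i < length τ → i < length (map suc τ)
    <length-map = subst (_ <_) (sym (length-map suc τ))

    at-wrap-suc : ∀ {i} → i < length τ → at (wrap τ) (suc i) ≡ suc (at τ i)
    at-wrap-suc i< = trans (at-++ˡ (map suc τ) [ 0 ] (<length-map i<)) (at-map suc τ i<)

    at-wrap-last : at (wrap τ) (suc (length τ)) ≡ 0
    at-wrap-last = trans (cong (at (map suc τ ++ [ 0 ])) (sym (length-map suc τ))) (at-length (map suc τ) 0 [])

    at-fixLast : ∀ {i} → i < length τ → at (fixLast τ) i ≡ at τ i
    at-fixLast = at-++ˡ τ [ length τ ]

    fixFirst² : ∀ {i} → i < length τ → at (fixFirst τ) (at (fixFirst τ) (suc i)) ≡ suc (at τ (at τ i))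
    fixFirst² i< = trans (cong (at (fixFirst τ)) (at-map suc τ i<)) (at-map suc τ (at< i<))

    fixLast² : ∀ {i} → i < length τ → at (fixLast τ) (at (fixLast τ) i) ≡ at τ (at τ i)
    fixLast² i< = trans (cong (at (fixLast τ)) (at-fixLast i<)) (at-fixLast (at< i<))

    wrap² : ∀ {i} → i < length τ → at (wrap τ) (at (wrap τ) (suc i)) ≡ suc (at τ (at τ i))
    wrap² i< = trans (cong (at (wrap τ)) (at-wrap-suc i<)) (at-wrap-suc (at< i<))

  Involutive-fixFirst : Involutive (fixFirst τ) ⇔ Involutive τ
  Involutive-fixFirst = mk⇔ to from
    where
    to : Involutive (fixFirst τ) → Involutive τ
    to inv i< = suc-injective (trans (sym (fixFirst² i<)) (inv (s<s (<length-map i<))))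
    from : Involutive τ → Involutive (fixFirst τ)
    from inv {zero}  _        = refl
    from inv {suc i} (s<s i<) = trans (fixFirst² i<′) (cong suc (inv i<′))
      where i<′ = subst (i <_) (length-map suc τ) i<

  Involutive-fixLast : Involutive (fixLast τ) ⇔ Involutive τ
  Involutive-fixLast = mk⇔ to from
    where
    to : Involutive (fixLast τ) → Involutive τ
    to inv i< = trans (sym (fixLast² i<)) (inv (subst (_ <_) (sym (length-∷ʳ τ _)) (m<n⇒m<1+n i<)))
    fixLast-last : at (fixLast τ) (length τ) ≡ length τ
    fixLast-last = at-length τ (length τ) []
    from : Involutive τ → Involutive (fixLast τ)
    from inv i< with m<1+n⇒m<n∨m≡n (subst (_ <_) (length-∷ʳ τ _) i<)
    ... | inj₁ i<′   = trans (fixLast² i<′) (inv i<′)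
    ... | inj₂ refl = trans (cong (at (fixLast τ)) fixLast-last) fixLast-last

  Involutive-wrap : Involutive (wrap τ) ⇔ Involutive τ
  Involutive-wrap = mk⇔ to from
    where
    to : Involutive (wrap τ) → Involutive τ
    to inv {i} i< = suc-injective (trans (sym (wrap² i<)) (inv (subst (suc i <_) (sym (length-wrap τ)) (s<s (m<n⇒m<1+n i<)))))
    from : Involutive τ → Involutive (wrap τ)
    from inv {zero}  _        = at-wrap-last
    from inv {suc i} (s<s i<) with m<1+n⇒m<n∨m≡n (subst (_ <_) (suc-injective (length-wrap τ)) i<)
    ... | inj₁ i<′   = trans (wrap² i<′) (cong suc (inv i<′))
    ... | inj₂ refl = cong (at (wrap τ)) at-wrap-last

module _ (π : List ℕ) where

  private
    noneAmongSubseqs : ∀ {P : ℕ → Set} (extend : List ℕ → List ℕ) {xs} → All P xs →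
                       (∀ s → All P s → ¬ T (sameOrder π (extend s))) →
                       count (sameOrder π ∘ extend) (subseqs xs) ≡ 0
    noneAmongSubseqs extend pxs ¬occ =
      count-≡0 (sameOrder π ∘ extend) (All.tabulate (λ s∈ → ¬occ _ (All-subseqs pxs s∈)))

  occurrences-fixFirst : (∀ s → ¬ T (sameOrder π (0 ∷ s))) → ∀ τ → occurrences π (fixFirst τ) ≡ occurrences π τ
  occurrences-fixFirst ¬0∷ τ = begin
    occurrences π (0 ∷ map suc τ)
      ≡⟨ count-subseqs-∷ (sameOrder π) 0 (map suc τ) ⟩
    count (sameOrder π ∘ (0 ∷_)) (subseqs (map suc τ)) + occurrences π (map suc τ)
      ≡⟨ cong (_+ occurrences π (map suc τ)) (count-≡0 _ (All.universal ¬0∷ (subseqs (map suc τ)))) ⟩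
    occurrences π (map suc τ)
      ≡⟨ occurrences-map-suc π τ ⟩
    occurrences π τ ∎
    where open ≡-Reasoning

  occurrences-fixLast : (∀ {M} s → All (_< M) s → ¬ T (sameOrder π (s ++ [ M ]))) →
                        ∀ {τ} → All (_< length τ) τ → occurrences π (fixLast τ) ≡ occurrences π τ
  occurrences-fixLast ¬∷ʳmax {τ} bnd = begin
    occurrences π (τ ++ [ length τ ])
      ≡⟨ count-subseqs-∷ʳ (sameOrder π) τ (length τ) ⟩
    count (sameOrder π ∘ (_++ [ length τ ])) (subseqs τ) + occurrences π τ
      ≡⟨ cong (_+ occurrences π τ) (noneAmongSubseqs (_++ [ length τ ]) bnd ¬∷ʳmax) ⟩
    occurrences π τ ∎
    where open ≡-Reasoning

  occurrences-wrap : (∀ {M} s → All (_< M) s → ¬ T (sameOrder π (M ∷ s))) →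
                     (∀ s → ¬ T (sameOrder π (s ++ [ 0 ]))) →
                     ∀ {τ} → All (_< length τ) τ → occurrences π (wrap τ) ≡ occurrences π τ
  occurrences-wrap ¬max∷ ¬∷ʳ0 {τ} bnd = begin
    occurrences π (suc n ∷ map suc τ ++ [ 0 ])
      ≡⟨ count-subseqs-∷ (sameOrder π) (suc n) (map suc τ ++ [ 0 ]) ⟩
    count (sameOrder π ∘ (suc n ∷_)) (subseqs (map suc τ ++ [ 0 ])) + occurrences π (map suc τ ++ [ 0 ])
      ≡⟨ cong (_+ occurrences π (map suc τ ++ [ 0 ])) (noneAmongSubseqs (suc n ∷_) middle< ¬max∷) ⟩
    occurrences π (map suc τ ++ [ 0 ])
      ≡⟨ count-subseqs-∷ʳ (sameOrder π) (map suc τ) 0 ⟩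
    count (sameOrder π ∘ (_++ [ 0 ])) (subseqs (map suc τ)) + occurrences π (map suc τ)
      ≡⟨ cong (_+ occurrences π (map suc τ)) (count-≡0 _ (All.universal ¬∷ʳ0 (subseqs (map suc τ)))) ⟩
    occurrences π (map suc τ)
      ≡⟨ occurrences-map-suc π τ ⟩
    occurrences π τ ∎
    where
    open ≡-Reasoning
    n = length τ
    middle< : All (_< suc n) (map suc τ ++ [ 0 ])
    middle< = AllP.++⁺ (map-suc-bounded bnd) (z<s ∷ [])

-- 3412 neither begins nor ends with its least or greatest entry, so all three constructions
-- preserve avoiding it.
inI3412-fixFirst : ∀ π → (∀ s → ¬ T (sameOrder π (0 ∷ s))) →
                   ∀ {n τ} → IsPerm n τ → inI3412 π (fixFirst τ) ≡ inI3412 π τ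
inI3412-fixFirst π ¬0∷ {τ = τ} p = inI3412-cong π (fixFirst τ) τ (Involutive-fixFirst (bounded-by-length p))
  (occurrences-fixFirst p3412 (¬sameOrder-0∷ p3412 {2} (s<s (s<s z<s)) z<s) τ)
  (occurrences-fixFirst π ¬0∷ τ)

inI3412-fixLast : ∀ π → (∀ {M} s → All (_< M) s → ¬ T (sameOrder π (s ++ [ M ]))) →
                  ∀ {n τ} → IsPerm n τ → inI3412 π (fixLast τ) ≡ inI3412 π τ
inI3412-fixLast π ¬∷ʳmax {τ = τ} p = inI3412-cong π (fixLast τ) τ (Involutive-fixLast bnd)
  (occurrences-fixLast p3412 (¬sameOrder-∷ʳmax p3412 {0} z<s refl (s<s z<s)) bnd)
  (occurrences-fixLast π ¬∷ʳmax bnd)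
  where bnd = bounded-by-length p

inI3412-wrap : ∀ π → (∀ {M} s → All (_< M) s → ¬ T (sameOrder π (M ∷ s))) →
               (∀ s → ¬ T (sameOrder π (s ++ [ 0 ]))) → ∀ {n τ} → IsPerm n τ → inI3412 π (wrap τ) ≡ inI3412 π τ
inI3412-wrap π ¬max∷ ¬∷ʳ0 {τ = τ} p = inI3412-cong π (wrap τ) τ (Involutive-wrap bnd)
  (occurrences-wrap p3412 (¬sameOrder-max∷ p3412 {1} (s<s z<s) ≤-refl) (¬sameOrder-∷ʳ0 p3412 {2} (s<s (s<s z<s)) refl z<s) bnd)
  (occurrences-wrap π ¬max∷ ¬∷ʳ0 bnd)
  where bnd = bounded-by-length p

fixFirst-view : ∀ {n rest} → IsPerm (suc n) (0 ∷ rest) → Σ[ τ ∈ List ℕ ] IsPerm n τ × 0 ∷ rest ≡ fixFirst τ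
fixFirst-view {n} {rest} record { length≡ = len ; bounded = _ ∷ rest< ; unique = 0∉ ∷ rest! } =
  τ , record { length≡ = lenτ ; bounded = τ< ; unique = UP.map⁻ (subst Unique (sym e) rest!) } , cong (0 ∷_) (sym e)
  where
  τ = proj₁ (map-suc-view rest rest< 0∉)
  e = proj₁ (proj₂ (map-suc-view rest rest< 0∉))
  τ< = proj₂ (proj₂ (map-suc-view rest rest< 0∉))
  lenτ : length τ ≡ n
  lenτ = trans (sym (length-map suc τ)) (trans (cong length e) (suc-injective len))

fixLast-view : ∀ {n ys} → IsPerm (suc n) (ys ++ [ n ]) → IsPerm n ys × ys ++ [ n ] ≡ fixLast ys
fixLast-view {n} {ys} record { length≡ = len ; bounded = σ< ; unique = σ! } =
  record { length≡ = lenys ; bounded = ys< ; unique = proj₂ (Unique-∷ʳ⁻ ys σ!) } ,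
  cong (λ k → ys ++ [ k ]) (sym lenys)
  where
  lenys : length ys ≡ n
  lenys = suc-injective (trans (sym (length-∷ʳ ys n)) len)
  ys< : All (_< n) ys
  ys< = All.zipWith (λ (x< , x≢n) → <-≢-pred x< x≢n) (AllP.++⁻ˡ ys σ< , proj₁ (Unique-∷ʳ⁻ ys σ!))

wrap-view : ∀ {m rest} → IsPerm (suc (suc m)) (suc m ∷ rest) → Involutive (suc m ∷ rest) →
            Σ[ τ ∈ List ℕ ] IsPerm m τ × suc m ∷ rest ≡ wrap τ
wrap-view {m} {rest} p inv with initLast rest | IsPerm.length≡ p | IsPerm.bounded p | IsPerm.unique p
... | [] | () | _ | _
... | ys ∷ʳ′ y | len | _ ∷ σ< | m+1∉ ∷ σ! = τ , record { length≡ = lenτ ; bounded = τ< ; unique = τ! } , shape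
  where
  lenys : length ys ≡ m
  lenys = suc-injective (trans (sym (length-∷ʳ ys y)) (suc-injective len))
  y≡0 : y ≡ 0
  y≡0 = trans (sym (trans (cong (at (ys ++ [ y ])) (sym lenys)) (at-length ys y []))) (inv z<s)
  ys≢0 : All (0 ≢_) ys
  ys≢0 = All.map (λ x≢y 0≡x → x≢y (trans (sym 0≡x) (sym y≡0))) (proj₁ (Unique-∷ʳ⁻ ys σ!))
  view = map-suc-view ys (AllP.++⁻ˡ ys σ<) ys≢0
  τ = proj₁ view
  e : map suc τ ≡ ys
  e = proj₁ (proj₂ view)
  lenτ : length τ ≡ m
  lenτ = trans (sym (length-map suc τ)) (trans (cong length e) lenys)
  τ< : All (_< m) τ
  τ< = All.zipWith (λ (x< , m+1≢x+1) → <-≢-pred x< (λ x≡m → m+1≢x+1 (cong suc (sym x≡m))))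
         (proj₂ (proj₂ view) , AllP.map⁻ (subst (All (suc m ≢_)) (sym e) (AllP.++⁻ˡ ys m+1∉)))
  τ! : Unique τ
  τ! = UP.map⁻ (subst Unique (sym e) (proj₂ (Unique-∷ʳ⁻ ys σ!)))
  shape : suc m ∷ ys ++ [ y ] ≡ wrap τ
  shape = cong₂ (λ k xs → suc k ∷ xs) (sym lenτ) (cong₂ (λ xs z → xs ++ [ z ]) (sym e) y≡0)

-- Signs

inversions-map-suc : ∀ xs → inversions (map suc xs) ≡ inversions xs
inversions-map-suc []       = refl
inversions-map-suc (a ∷ xs) = cong₂ _+_ (count-map (_<ᵇ suc a) suc xs) (inversions-map-suc xs)

inversions-∷ʳ : ∀ xs y → inversions (xs ++ [ y ]) ≡ inversions xs + count (y <ᵇ_) xs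
inversions-∷ʳ []       y = refl
inversions-∷ʳ (a ∷ xs) y rewrite count-++ (_<ᵇ a) xs [ y ] | inversions-∷ʳ xs y with y <ᵇ a
... | true  = shuffle (count (_<ᵇ a) xs) (inversions xs) (count (y <ᵇ_) xs)
  where
  shuffle : ∀ c i d → c + 1 + (i + d) ≡ c + i + suc d
  shuffle = solve-∀
... | false = shuffle (count (_<ᵇ a) xs) (inversions xs) (count (y <ᵇ_) xs)
  where
  shuffle : ∀ c i d → c + 0 + (i + d) ≡ c + i + d
  shuffle = solve-∀

sign-cong : ∀ σ τ → inversions σ ≡ inversions τ → sign σ ≡ sign τ
sign-cong σ τ eq rewrite eq = refl

sign-cong₂ : ∀ σ τ → inversions σ ≡ 2 + inversions τ → sign σ ≡ sign τ
sign-cong₂ σ τ eq rewrite eq = refl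

-- The parity function inside `sign` is local to it, so parities are read off
-- a reference list with a prescribed number of inversions.
withInversions : ℕ → List ℕ
withInversions k = 1 ∷ replicate k 0

inversions-withInversions : ∀ k → inversions (withInversions k) ≡ k
inversions-withInversions k = trans (cong₂ _+_ (below1 k) (zeros k)) (+-identityʳ k)
  where
  below1 : ∀ k → count (_<ᵇ 1) (replicate k 0) ≡ k
  below1 zero    = refl
  below1 (suc k) = cong suc (below1 k)
  zeros : ∀ k → inversions (replicate k 0) ≡ 0
  zeros zero    = refl
  zeros (suc k) = trans (cong (_+ inversions (replicate k 0)) (count-≡0 (_<ᵇ 0) (All.universal (λ _ ()) (replicate k 0)))) (zeros k)

parity : ℕ → ℤ
parity k = sign (withInversions k)

sign≡parity : ∀ σ → sign σ ≡ parity (inversions σ)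
sign≡parity σ = sign-cong σ (withInversions (inversions σ)) (sym (inversions-withInversions _))

parity-suc-suc : ∀ k → parity (2 + k) ≡ parity k
parity-suc-suc k = sign-cong₂ (withInversions (2 + k)) (withInversions k)
  (trans (inversions-withInversions _) (cong (2 +_) (sym (inversions-withInversions k))))

parity-suc : ∀ k → parity (suc k) ≡ ℤ.- parity k
parity-suc zero          = refl
parity-suc (suc zero)    = parity-suc-suc 0
parity-suc (suc (suc k)) = trans (parity-suc-suc (suc k)) (trans (parity-suc k) (cong ℤ.-_ (sym (parity-suc-suc k))))

parity-double+ : ∀ m k → parity (m + m + k) ≡ parity k
parity-double+ zero    k = refl
parity-double+ (suc m) k =
  trans (cong (λ x → parity (suc x + k)) (+-suc m m)) (trans (parity-suc-suc (m + m + k)) (parity-double+ m k))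

sign-fixFirst : ∀ τ → sign (fixFirst τ) ≡ sign τ
sign-fixFirst τ = sign-cong (fixFirst τ) τ
  (trans (cong (_+ inversions (map suc τ)) (count-≡0 (_<ᵇ 0) (All.universal (λ _ ()) (map suc τ))))
         (inversions-map-suc τ))

sign-fixLast : ∀ {τ} → All (_< length τ) τ → sign (fixLast τ) ≡ sign τ
sign-fixLast {τ} bnd = sign-cong (fixLast τ) τ (begin
  inversions (τ ++ [ length τ ])                   ≡⟨ inversions-∷ʳ τ (length τ) ⟩
  inversions τ + count (length τ <ᵇ_) τ            ≡⟨ cong (inversions τ +_) (count-≡0 _ (All.map ¬n<ᵇ bnd)) ⟩
  inversions τ + 0                                 ≡⟨ +-identityʳ _ ⟩
  inversions τ                                     ∎)
  where
  open ≡-Reasoning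
  ¬n<ᵇ : ∀ {a} → a < length τ → ¬ T (length τ <ᵇ a)
  ¬n<ᵇ a<n t = <-asym a<n (<ᵇ⇒< _ _ t)

sign-wrap : ∀ {τ} → All (_< length τ) τ → sign (wrap τ) ≡ ℤ.- sign τ
sign-wrap {τ} bnd = begin
  sign (wrap τ)                      ≡⟨ sign≡parity (wrap τ) ⟩
  parity (inversions (wrap τ))       ≡⟨ cong parity inversions-wrap ⟩
  parity (suc (n + n + inversions τ)) ≡⟨ parity-suc (n + n + inversions τ) ⟩
  ℤ.- parity (n + n + inversions τ)  ≡⟨ cong ℤ.-_ (parity-double+ n (inversions τ)) ⟩
  ℤ.- parity (inversions τ)          ≡⟨ cong ℤ.-_ (sym (sign≡parity τ)) ⟩
  ℤ.- sign τ                         ∎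
  where
  open ≡-Reasoning
  n = length τ
  middle = map suc τ ++ [ 0 ]
  lengthMiddle : length middle ≡ suc n
  lengthMiddle = trans (length-∷ʳ (map suc τ) 0) (cong suc (length-map suc τ))
  firstBeatsAll : count (_<ᵇ suc n) middle ≡ suc n
  firstBeatsAll = trans (count-≡length _ (All.map <⇒<ᵇ (AllP.++⁺ (map-suc-bounded bnd) (z<s ∷ [])))) lengthMiddle
  lastLosesAll : count (0 <ᵇ_) (map suc τ) ≡ n
  lastLosesAll = trans (count-≡length _ (AllP.map⁺ (All.universal (λ _ → tt) τ))) (length-map suc τ)
  inversions-wrap : inversions (wrap τ) ≡ suc (n + n + inversions τ)
  inversions-wrap = begin
    count (_<ᵇ suc n) middle + inversions middle
      ≡⟨ cong₂ _+_ firstBeatsAll (inversions-∷ʳ (map suc τ) 0) ⟩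
    suc n + (inversions (map suc τ) + count (0 <ᵇ_) (map suc τ))
      ≡⟨ cong (λ x → suc n + (x + count (0 <ᵇ_) (map suc τ))) (inversions-map-suc τ) ⟩
    suc n + (inversions τ + count (0 <ᵇ_) (map suc τ))
      ≡⟨ cong (λ x → suc n + (inversions τ + x)) lastLosesAll ⟩
    suc n + (inversions τ + n)
      ≡⟨ rearrange n (inversions τ) ⟩
    suc (n + n + inversions τ) ∎
    where
    rearrange : ∀ a b → suc a + (b + a) ≡ suc (a + a + b)
    rearrange = solve-∀

-- Classification

OccursAtMostOnce : (ℕ → ℕ → ℕ → Set) → Set
OccursAtMostOnce Is = ∀ {i j l i′ j′ l′} → Is i j l → Is i′ j′ l′ → i ≡ i′ × j ≡ j′ × l ≡ l′

module InvolutionShapes (f : ℕ → ℕ) (n : ℕ)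
  (f< : ∀ {i} → i < n → f i < n)
  (f-inv : ∀ {i} → i < n → f (f i) ≡ i)
  (avoids3412 : ∀ {i j l m} → i < j → j < l → l < m → m < n → f l < f m → f m < f i → f i < f j → ⊥)
  where

  f-swap : ∀ {a b} → a < n → f a ≡ b → f b ≡ a
  f-swap a< fa≡b = trans (cong f (sym fa≡b)) (f-inv a<)

  preimages-differ : ∀ {a b x y} → f a ≡ x → f b ≡ y → x ≢ y → a ≢ b
  preimages-differ fa fb x≢y refl = x≢y (trans (sym fa) fb)

  Is213 : ℕ → ℕ → ℕ → Set
  Is213 i j l = i < j × j < l × l < n × f j < f i × f i < f l

  Is132 : ℕ → ℕ → ℕ → Set
  Is132 i j l = i < j × j < l × l < n × f i < f l × f l < f j

  module FirstEntry (once : OccursAtMostOnce Is213) where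

    first≡1 : f 0 ≡ 1 → 2 < n → n ≡ 3 × f 1 ≡ 0 × f 2 ≡ 2
    first≡1 f0 2<n = n≡3 , f1 , ≤-antisym (≤-pred (subst (f 2 <_) n≡3 (f< 2<n))) (above1 2<n (s<s z<s))
      where
      f1 : f 1 ≡ 0
      f1 = f-swap (<-trans z<s 2<n) f0
      above1 : ∀ {x} → x < n → 1 < x → 1 < f x
      above1 x< 1<x = 1<n (λ fx≡0 → <-irrefl (trans (sym f0) (f-swap x< fx≡0)) 1<x)
                          (λ fx≡1 → <-irrefl (trans (sym f1) (f-swap x< fx≡1)) (<-trans z<s 1<x))
      01l-is213 : ∀ {l} → 1 < l → l < n → Is213 0 1 l
      01l-is213 1<l l<n = z<s , 1<l , l<n , ≡<≡ f1 f0 z<s , ≡<≡ f0 refl (above1 l<n 1<l)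
      n≡3 : n ≡ 3
      n≡3 = ≤-antisym (≮⇒≥ λ 3<n → 2≢3 (proj₂ (proj₂ (once (01l-is213 (s<s z<s) 2<n) (01l-is213 (s<s z<s) 3<n)))))
        2<n
        where
        2≢3 : 2 ≢ 3
        2≢3 ()

    -- Here f k = 0. If f 1 > k then (0, 1, k, f 1) is a 3412. Otherwise, with p = f v, p < k gives
    -- the 3412 (0, p, k, v) and p > k the two 213s (0, 1, p) and (0, k, p).
    module _ {k v} (f0 : f 0 ≡ k) (1<k : 1 < k) (k<v : k < v) (v<n : v < n) where

      private
        0<k = <-trans z<s 1<k
        k<n = <-trans k<v v<n
        1<n′ = <-trans 1<k k<n
        fk : f k ≡ 0
        fk = f-swap (≤-<-trans z≤n k<n) f0
        p = f v
        p<n = f< v<n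
        fp : f p ≡ v
        fp = f-inv v<n

        whenLastAbove : k < p → f 1 < k → ⊥
        whenLastAbove k<p f1<k = <-irrefl 1≡k 1<k
          where
          1≡k = proj₁ (proj₂ (once (z<s , <-trans 1<k k<p , p<n , ≡<≡ refl f0 f1<k , ≡<≡ f0 fp k<v)
                                   (0<k , k<p , p<n , ≡<≡ fk f0 0<k , ≡<≡ f0 fp k<v)))

        whenLastBelow : p < k → ⊥
        whenLastBelow p<k = avoids3412 0<p p<k k<v v<n (≡<≡ fk refl 0<p) (≡<≡ refl f0 p<k) (≡<≡ f0 fp k<v)
          where
          0<p : 0 < p
          0<p = n≢0⇒n>0 (preimages-differ fp f0 (λ v≡k → <-irrefl (sym v≡k) k<v))

        whenSecondBelow : f 1 < k → ⊥
        whenSecondBelow f1<k with <-cmp p k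
        ... | tri< p<k _ _ = whenLastBelow p<k
        ... | tri≈ _ p≡k _ = <-irrefl (trans (sym fk) (subst (λ x → f x ≡ v) p≡k fp)) (≤-<-trans z≤n k<v)
        ... | tri> _ _ k<p = whenLastAbove k<p f1<k

      first≥2 : ⊥
      first≥2 with <-cmp (f 1) k
      ... | tri< f1<k _ _ = whenSecondBelow f1<k
      ... | tri≈ _ f1≡k _ = 0≢1 (trans (sym fk) (f-swap 1<n′ f1≡k))
        where
        0≢1 : 0 ≢ 1
        0≢1 ()
      ... | tri> _ _ k<f1 = avoids3412 z<s 1<k k<f1 (f< 1<n′)
        (≡<≡ fk (f-swap 1<n′ refl) z<s) (≡<≡ (f-swap 1<n′ refl) f0 1<k) (≡<≡ f0 refl k<f1)

    first-shape : ∀ {k} → f 0 ≡ k → 0 < k → suc k < n → n ≡ 3 × f 0 ≡ 1 × f 1 ≡ 0 × f 2 ≡ 2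
    first-shape {suc zero}    f0 _ 2<n = let n≡3 , f1 , f2 = first≡1 f0 2<n in n≡3 , f0 , f1 , f2
    first-shape {suc (suc k)} f0 _ k+1<n = ⊥-elim (first≥2 f0 (s<s z<s) ≤-refl k+1<n)

  module LastEntry (once : OccursAtMostOnce Is132) where

    private
      last<n : ∀ {u} → n ≡ suc (suc u) → suc u < n
      last<n n≡ = subst (_ <_) (sym n≡) ≤-refl

    othersBelow : ∀ {u x} → n ≡ suc (suc u) → f (suc u) ≡ u → x < n → x ≢ u → x ≢ suc u → f x < u
    othersBelow {u} {x} n≡ fv x< x≢u x≢v = <2+n∧≢⇒< (subst (f x <_) n≡ (f< x<))
      (λ fx≡u → x≢v (trans (sym (f-swap x< fx≡u)) (f-swap (last<n n≡) fv)))
      (λ fx≡v → x≢u (trans (sym (f-swap x< fx≡v)) fv))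

    last≡prev : ∀ {u} → n ≡ suc (suc u) → f (suc u) ≡ u → 0 < u → u ≡ 1 × f 0 ≡ 0
    last≡prev {suc zero}    n≡ fv _ = refl , n<1⇒n≡0 (othersBelow n≡ fv (subst (0 <_) (sym n≡) z<s) (λ ()) (λ ()))
    last≡prev {suc (suc s)} n≡ fv _ = ⊥-elim (1+n≢n (proj₁ (once (is132 (n<1+n (suc s))) (is132 (m<n⇒m<1+n (n<1+n s))))))
      where
      u = suc (suc s)
      is132 : ∀ {i} → i < u → Is132 i u (suc u)
      is132 {i} i<u = i<u , ≤-refl , last<n n≡ ,
        ≡<≡ refl fv (othersBelow n≡ fv (<-trans i<u (<-trans ≤-refl (last<n n≡))) (<⇒≢ i<u) (<⇒≢ (m<n⇒m<1+n i<u))) ,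
        ≡<≡ fv (f-swap (last<n n≡) fv) ≤-refl

    -- Here f k = u+1. With w = f u, w < k gives the 3412 (w, k, u, u+1). Otherwise, with p = f 0,
    -- p < k gives the two 132s (p, u, u+1) and (p, k, u+1), and p > k the 3412 (0, k, p, u+1).
    module _ {u k} (n≡ : n ≡ suc (suc u)) (fv : f (suc u) ≡ k) (0<k : 0 < k) (k<u : k < u) where

      private
        v<n = last<n n≡
        k<v = m<n⇒m<1+n k<u
        fk : f k ≡ suc u
        fk = f-swap v<n fv
        w = f u
        fw : f w ≡ u
        fw = f-inv (<-trans ≤-refl v<n)
        p = f 0
        fp : f p ≡ 0
        fp = f-inv (≤-<-trans z≤n v<n)

        whenPrevBelow : w < k → ⊥
        whenPrevBelow w<k = avoids3412 w<k k<u ≤-refl v<n (≡<≡ refl fv w<k) (≡<≡ fv fw k<u) (≡<≡ fw fk ≤-refl)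

        whenFirstBelow : k < w → p < k → ⊥
        whenFirstBelow k<w p<k = <-irrefl (sym u≡k) k<u
          where
          u≡k = proj₁ (proj₂ (once (<-trans p<k k<u , ≤-refl , v<n , ≡<≡ fp fv 0<k , ≡<≡ fv refl k<w)
                                   (p<k , k<v , v<n , ≡<≡ fp fv 0<k , ≡<≡ fv fk k<v)))

        whenFirstAbove : k < p → ⊥
        whenFirstAbove k<p = avoids3412 0<k k<p p<v v<n (≡<≡ fp fv 0<k) (≡<≡ fv refl k<p) (≡<≡ refl fk p<v)
          where
          p<v : p < suc u
          p<v = ≤∧≢⇒< (≤-pred (subst (p <_) n≡ (f< (≤-<-trans z≤n v<n))))
                      (preimages-differ fp fv (<⇒≢ 0<k))

        whenPrevAbove : k < w → ⊥
        whenPrevAbove k<w with <-cmp p k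
        ... | tri< p<k _ _ = whenFirstBelow k<w p<k
        ... | tri≈ _ p≡k _ = preimages-differ fp fk (λ ()) p≡k
        ... | tri> _ _ k<p = whenFirstAbove k<p

      last<prev : ⊥
      last<prev with <-cmp w k
      ... | tri< w<k _ _ = whenPrevBelow w<k
      ... | tri≈ _ w≡k _ = <-irrefl (trans (sym (subst (λ x → f x ≡ u) w≡k fw)) fk) (n<1+n u)
      ... | tri> _ _ k<w = whenPrevAbove k<w

    last-shape : ∀ {v k} → n ≡ suc v → f v ≡ k → 0 < k → k < v → n ≡ 3 × f 0 ≡ 0 × f 1 ≡ 2 × f 2 ≡ 1
    last-shape {suc u} n≡ fv 0<k (s≤s k≤u) with m≤n⇒m<n∨m≡n k≤u
    ... | inj₁ k<u = ⊥-elim (last<prev n≡ fv 0<k k<u)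
    ... | inj₂ refl with last≡prev n≡ fv 0<k
    ...   | refl , f0 = n≡ , f0 , f-swap (last<n n≡) fv , fv

data Decomposition (extend : List ℕ → List ℕ) (base : List ℕ) (m : ℕ) (σ : List ℕ) : Set where
  extended : ∀ {τ} → IsPerm (suc m) τ → σ ≡ extend τ → Decomposition extend base m σ
  wrapped  : ∀ {τ} → IsPerm m τ → σ ≡ wrap τ → Decomposition extend base m σ
  isBase   : m ≡ 1 → σ ≡ base → Decomposition extend base m σ

classify213 : ∀ {m σ} → IsPerm (suc (suc m)) σ → InI3412 p213 σ → Decomposition fixFirst p213 m σ
classify213 {m} {h ∷ rest} p I with h ≟ 0 | h ≟ suc m
... | yes refl | _ = let _ , pτ , e = fixFirst-view p in extended pτ e
... | no _ | yes refl = let _ , pτ , e = wrap-view p (InI3412.involutive I) in wrapped pτ e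
... | no h≢0 | no h≢m+1 = isBase (suc-injective (suc-injective (trans (sym len) n≡3)))
                                 (trans (length3 σ n≡3) (cong₂ _∷_ f0 (cong₂ _∷_ f1 (cong [_] f2))))
  where
  σ = h ∷ rest
  open InI3412 I
  open IsPerm p using () renaming (length≡ to len)
  open InvolutionShapes (at σ) (length σ) (at-All (bounded-by-length p)) involutive (avoids3412⇒noIndices σ avoids3412)
  once : OccursAtMostOnce Is213
  once (i<j , j<l , l< , b<a , a<c) (i′<j′ , j′<l′ , l′< , b′<a′ , a′<c′) =
    occursOnce⇒sameIndices involutive containsOnce i<j j<l l< i′<j′ j′<l′ l′<
      (213-occurrence b<a a<c) (213-occurrence b′<a′ a′<c′)
  open FirstEntry once
  h<m+1 : h < suc m
  h<m+1 = <-≢-pred (All.head (IsPerm.bounded p)) h≢m+1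
  shape = first-shape refl (n≢0⇒n>0 h≢0) (subst (suc h <_) (sym len) (s<s h<m+1))
  n≡3 = proj₁ shape
  f0 = proj₁ (proj₂ shape)
  f1 = proj₁ (proj₂ (proj₂ shape))
  f2 = proj₂ (proj₂ (proj₂ shape))

classify132 : ∀ {m σ} → IsPerm (suc (suc m)) σ → InI3412 p132 σ → Decomposition fixLast p132 m σ
classify132 {m} {h ∷ rest} p I with h ≟ suc m | ∷ʳ-view (h ∷ rest) (λ ())
... | yes refl | _ = let _ , pτ , e = wrap-view p (InI3412.involutive I) in wrapped pτ e
... | no h≢m+1 | ys , y , σ≡ with y ≟ suc m
...   | yes refl = let pτ , e = fixLast-view (subst (IsPerm _) σ≡ p) in extended pτ (trans σ≡ e)
...   | no y≢m+1 = isBase (suc-injective (suc-injective (trans (sym len) n≡3)))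
                          (trans (length3 σ n≡3) (cong₂ _∷_ f0 (cong₂ _∷_ f1 (cong [_] f2))))
  where
  σ = h ∷ rest
  open InI3412 I
  open IsPerm p using () renaming (length≡ to len)
  open InvolutionShapes (at σ) (length σ) (at-All (bounded-by-length p)) involutive (avoids3412⇒noIndices σ avoids3412)
  once : OccursAtMostOnce Is132
  once (i<j , j<l , l< , a<c , c<b) (i′<j′ , j′<l′ , l′< , a′<c′ , c′<b′) =
    occursOnce⇒sameIndices involutive containsOnce i<j j<l l< i′<j′ j′<l′ l′<
      (132-occurrence a<c c<b) (132-occurrence a′<c′ c′<b′)
  open LastEntry once
  lenys : length ys ≡ suc m
  lenys = suc-injective (trans (sym (length-∷ʳ ys y)) (trans (cong length (sym σ≡)) len))
  last≡y : at σ (suc m) ≡ y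
  last≡y = trans (cong (λ xs → at xs (suc m)) σ≡) (trans (cong (at (ys ++ [ y ])) (sym lenys)) (at-length ys y []))
  y<m+2 : y < suc (suc m)
  y<m+2 = All.lookup (subst (All (_< suc (suc m))) σ≡ (IsPerm.bounded p)) (∈-++⁺ʳ ys (here refl))
  0<y : 0 < y
  0<y = n≢0⇒n>0 (λ y≡0 → h≢m+1 (f-swap (subst (suc m <_) (sym len) ≤-refl) (trans last≡y y≡0)))
  shape = last-shape len last≡y 0<y (<-≢-pred y<m+2 y≢m+1)
  n≡3 = proj₁ shape
  f0 = proj₁ (proj₂ shape)
  f1 = proj₁ (proj₂ (proj₂ shape))
  f2 = proj₂ (proj₂ (proj₂ shape))

-- The recurrences

sumℤ : List ℤ → ℤ
sumℤ = foldr ℤ._+_ (ℤ.+ 0)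

sumℤ-++ : ∀ xs ys → sumℤ (xs ++ ys) ≡ sumℤ xs ℤ.+ sumℤ ys
sumℤ-++ []       ys = sym (ℤP.+-identityˡ _)
sumℤ-++ (x ∷ xs) ys = trans (cong (λ s → x ℤ.+ s) (sumℤ-++ xs ys)) (sym (ℤP.+-assoc x _ _))

sumℤ-↭ : ∀ {xs ys} → xs ↭ ys → sumℤ xs ≡ sumℤ ys
sumℤ-↭ = foldr-commMonoid ℤP.+-0-isCommutativeMonoid ∘ ↭⇒↭ₛ

sumℤ-neg : ∀ xs → sumℤ (map ℤ.-_ xs) ≡ ℤ.- sumℤ xs
sumℤ-neg []       = refl
sumℤ-neg (x ∷ xs) = trans (cong (λ s → ℤ.- x ℤ.+ s) (sumℤ-neg xs)) (sym (ℤP.neg-distrib-+ x (sumℤ xs)))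

-- Gplus π n counts I π n, and Gminus π n is definitionally sumℤ (map sign (I π n)).
I : List ℕ → ℕ → List (List ℕ)
I π n = filter (T? ∘ inI3412 π) (perms n)

∈I⁻ : ∀ π n {σ} → σ ∈ I π n → IsPerm n σ × T (inI3412 π σ)
∈I⁻ π n σ∈ = let σ∈perms , t = ∈-filter⁻ (T? ∘ inI3412 π) {xs = perms n} σ∈ in perms⁻ σ∈perms , t

∈I⁺ : ∀ π n {σ} → IsPerm n σ → T (inI3412 π σ) → σ ∈ I π n
∈I⁺ π n p t = ∈-filter⁺ (T? ∘ inI3412 π) (perms⁺ p) t

I-unique : ∀ π n → Unique (I π n)
I-unique π n = UP.filter⁺ (T? ∘ inI3412 π) (perms-unique n)

Gplus≡length : ∀ π n → Gplus π n ≡ ℤ.+ length (I π n)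
Gplus≡length π n = cong ℤ.+_ (count≡length-filter (inI3412 π) (perms n))

module Recurrence
  (π : List ℕ) (extend : List ℕ → List ℕ)
  (IsPerm-extend : ∀ {n τ} → IsPerm n τ → IsPerm (suc n) (extend τ))
  (inI3412-extend : ∀ {n τ} → IsPerm n τ → inI3412 π (extend τ) ≡ inI3412 π τ)
  (inI3412-wrap : ∀ {n τ} → IsPerm n τ → inI3412 π (wrap τ) ≡ inI3412 π τ)
  (classify : ∀ {m σ} → IsPerm (suc (suc m)) σ → InI3412 π σ → Decomposition extend π m σ)
  (π∈I : π ∈ I π 3)
  (extend-injective : ∀ {τ τ′} → extend τ ≡ extend τ′ → τ ≡ τ′)
  (extend≢wrap : ∀ {n τ τ′} → IsPerm (suc n) τ → extend τ ≢ wrap τ′)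
  (extend≢π : ∀ {τ} → IsPerm 2 τ → extend τ ≢ π)
  (wrap≢π : ∀ τ → wrap τ ≢ π)
  (sign-extend : ∀ {n τ} → IsPerm n τ → sign (extend τ) ≡ sign τ)
  where

  base : ℕ → List (List ℕ)
  base (suc zero) = π ∷ []
  base _          = []

  decomposed : ℕ → List (List ℕ)
  decomposed m = map extend (I π (suc m)) ++ map wrap (I π m) ++ base m

  private
    to : ∀ m {σ} → σ ∈ I π (suc (suc m)) → σ ∈ decomposed m
    to m σ∈ with ∈I⁻ π (suc (suc m)) σ∈
    ... | p , t with classify {m} p (inI3412⇒InI3412 π _ t)
    ... | extended pτ refl = ∈-++⁺ˡ (∈-map⁺ extend (∈I⁺ π (suc m) pτ (subst T (inI3412-extend pτ) t)))
    ... | wrapped pτ refl =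
      ∈-++⁺ʳ (map extend (I π (suc m))) (∈-++⁺ˡ (∈-map⁺ wrap (∈I⁺ π m pτ (subst T (inI3412-wrap pτ) t))))
    ... | isBase refl refl = ∈-++⁺ʳ (map extend (I π 2)) (∈-++⁺ʳ (map wrap (I π 1)) (here refl))

    from : ∀ m {σ} → σ ∈ decomposed m → σ ∈ I π (suc (suc m))
    from m σ∈ with ∈-++⁻ (map extend (I π (suc m))) σ∈
    ... | inj₁ σ∈₁ with ∈-map⁻ extend σ∈₁
    ...   | τ , τ∈ , refl = let pτ , t = ∈I⁻ π (suc m) τ∈ in
                            ∈I⁺ π _ (IsPerm-extend pτ) (subst T (sym (inI3412-extend pτ)) t)
    from m σ∈ | inj₂ σ∈₂ with ∈-++⁻ (map wrap (I π m)) σ∈₂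
    ... | inj₁ σ∈₃ with ∈-map⁻ wrap σ∈₃
    ...   | τ , τ∈ , refl = let pτ , t = ∈I⁻ π m τ∈ in ∈I⁺ π _ (IsPerm-wrap pτ) (subst T (sym (inI3412-wrap pτ)) t)
    from (suc zero) σ∈ | inj₂ σ∈₂ | inj₂ (here refl) = π∈I

    wrap-injective : ∀ {τ τ′} → wrap τ ≡ wrap τ′ → τ ≡ τ′
    wrap-injective e = map-injective suc-injective (∷ʳ-injectiveˡ _ _ (proj₂ (∷-injective e)))

    base-unique : ∀ m → Unique (base m)
    base-unique zero          = []
    base-unique (suc zero)    = [] ∷ []
    base-unique (suc (suc m)) = []

    wrap-disjoint-base : ∀ m {σ} → ¬ (σ ∈ map wrap (I π m) × σ ∈ base m)
    wrap-disjoint-base (suc zero) (σ∈ , here refl) with ∈-map⁻ wrap σ∈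
    ... | τ , _ , e = wrap≢π τ (sym e)

    extend-disjoint-rest : ∀ m {σ} → ¬ (σ ∈ map extend (I π (suc m)) × σ ∈ map wrap (I π m) ++ base m)
    extend-disjoint-rest m (σ∈ , σ∈′) with ∈-map⁻ extend σ∈ | ∈-++⁻ (map wrap (I π m)) σ∈′
    ... | τ , τ∈ , e | inj₁ σ∈″ with ∈-map⁻ wrap σ∈″
    ...   | τ′ , _ , e′ = extend≢wrap (proj₁ (∈I⁻ π (suc m) τ∈)) (trans (sym e) e′)
    extend-disjoint-rest (suc zero) (σ∈ , _) | τ , τ∈ , e | inj₂ (here refl) = extend≢π (proj₁ (∈I⁻ π 2 τ∈)) (sym e)

    decomposed-unique : ∀ m → Unique (decomposed m)
    decomposed-unique m =
      UP.++⁺ (UP.map⁺ extend-injective (I-unique π (suc m)))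
             (UP.++⁺ (UP.map⁺ wrap-injective (I-unique π m)) (base-unique m) (wrap-disjoint-base m))
             (extend-disjoint-rest m)

  I↭decomposed : ∀ m → I π (suc (suc m)) ↭ decomposed m
  I↭decomposed m = ∼bag⇒↭ (unique∧set⇒bag (I-unique π (suc (suc m))) (decomposed-unique m) (mk⇔ (to m) (from m)))

  Gplus-recurrence : ∀ k → Gplus π (4 + k) ≡ Gplus π (3 + k) ℤ.+ Gplus π (2 + k)
  Gplus-recurrence k = begin
    Gplus π (4 + k)
      ≡⟨ Gplus≡length π (4 + k) ⟩
    ℤ.+ length (I π (4 + k))
      ≡⟨ cong ℤ.+_ (↭.↭-length (I↭decomposed (2 + k))) ⟩
    ℤ.+ length (map extend A ++ map wrap B ++ [])
      ≡⟨ cong ℤ.+_ (length-++ (map extend A) {map wrap B ++ []}) ⟩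
    ℤ.+ (length (map extend A) + length (map wrap B ++ []))
      ≡⟨ cong ℤ.+_ (cong₂ _+_ (length-map extend A) (trans (cong length (++-identityʳ (map wrap B))) (length-map wrap B))) ⟩
    ℤ.+ (length A + length B)
      ≡⟨ ℤP.pos-+ (length A) (length B) ⟩
    ℤ.+ length A ℤ.+ ℤ.+ length B
      ≡⟨ cong₂ ℤ._+_ (Gplus≡length π (3 + k)) (Gplus≡length π (2 + k)) ⟨
    Gplus π (3 + k) ℤ.+ Gplus π (2 + k) ∎
    where
    open ≡-Reasoning
    A = I π (3 + k)
    B = I π (2 + k)

  Gminus-recurrence : ∀ k → Gminus π (4 + k) ≡ Gminus π (3 + k) ℤ.- Gminus π (2 + k)
  Gminus-recurrence k = begin
    sumℤ (map sign (I π (4 + k)))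
      ≡⟨ sumℤ-↭ (↭.map⁺ sign (I↭decomposed (2 + k))) ⟩
    sumℤ (map sign (map extend A ++ map wrap B ++ []))
      ≡⟨ cong sumℤ (map-++ sign (map extend A) (map wrap B ++ [])) ⟩
    sumℤ (map sign (map extend A) ++ map sign (map wrap B ++ []))
      ≡⟨ sumℤ-++ (map sign (map extend A)) (map sign (map wrap B ++ [])) ⟩
    sumℤ (map sign (map extend A)) ℤ.+ sumℤ (map sign (map wrap B ++ []))
      ≡⟨ cong₂ ℤ._+_ (cong sumℤ (signs-extend (3 + k))) (cong (sumℤ ∘ map sign) (++-identityʳ (map wrap B))) ⟩
    sumℤ (map sign A) ℤ.+ sumℤ (map sign (map wrap B))
      ≡⟨ cong (λ s → sumℤ (map sign A) ℤ.+ s) (trans (cong sumℤ (signs-wrap (2 + k))) (sumℤ-neg (map sign B))) ⟩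
    sumℤ (map sign A) ℤ.- sumℤ (map sign B) ∎
    where
    open ≡-Reasoning
    A = I π (3 + k)
    B = I π (2 + k)
    signs-extend : ∀ n → map sign (map extend (I π n)) ≡ map sign (I π n)
    signs-extend n = trans (sym (map-∘ (I π n)))
      (map-cong-local (All.tabulate (λ τ∈ → sign-extend (proj₁ (∈I⁻ π n τ∈)))))
    signs-wrap : ∀ n → map sign (map wrap (I π n)) ≡ map ℤ.-_ (map sign (I π n))
    signs-wrap n = trans (sym (map-∘ (I π n))) (trans
      (map-cong-local (All.tabulate (λ τ∈ → sign-wrap (bounded-by-length (proj₁ (∈I⁻ π n τ∈))))))
      (map-∘ (I π n)))

module Recurrence213 = Recurrence p213 fixFirst IsPerm-fixFirst
  (inI3412-fixFirst p213 (¬sameOrder-0∷ p213 {1} (s<s z<s) z<s))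
  (inI3412-wrap p213 (¬sameOrder-max∷ p213 {2} (s<s (s<s z<s)) (s<s z<s)) (¬sameOrder-∷ʳ0 p213 {1} (s<s z<s) refl z<s))
  classify213 (here refl)
  (λ e → map-injective suc-injective (proj₂ (∷-injective e))) (λ _ ()) (λ _ ())
  (λ τ e → case ∷ʳ-injectiveʳ (suc (length τ) ∷ map suc τ) (1 ∷ 0 ∷ []) e of λ ())
  (λ {_} {τ} _ → sign-fixFirst τ)

module Recurrence132 = Recurrence p132 fixLast IsPerm-fixLast
  (inI3412-fixLast p132 (¬sameOrder-∷ʳmax p132 {1} (s<s z<s) refl (s<s z<s)))
  (inI3412-wrap p132 (¬sameOrder-max∷ p132 {1} (s<s z<s) z<s) (¬sameOrder-∷ʳ0 p132 {0} z<s refl z<s))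
  classify132 (here refl)
  (∷ʳ-injectiveˡ _ _)
  (λ {_} {τ} {τ′} p e → case trans (sym (IsPerm.length≡ p)) (∷ʳ-injectiveʳ τ (suc (length τ′) ∷ map suc τ′) e) of λ ())
  (λ {τ} p e → case trans (sym (IsPerm.length≡ p)) (∷ʳ-injectiveʳ τ (0 ∷ 2 ∷ []) e) of λ ())
  (λ _ ())
  (sign-fixLast ∘ bounded-by-length)

-- Generating functions

IsQuotient-x³/1-x-x² : ∀ (a : ℕ → ℤ) → a 0 ≡ ℤ.+ 0 → a 1 ≡ ℤ.+ 0 → a 2 ≡ ℤ.+ 0 → a 3 ≡ ℤ.+ 1 →
                       (∀ k → a (4 + k) ≡ a (3 + k) ℤ.+ a (2 + k)) → IsQuotient a x³ 1-x-x²
IsQuotient-x³/1-x-x² a a0 a1 a2 a3 rec = coeff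
  where
  coeff : IsQuotient a x³ 1-x-x²
  coeff 0 rewrite a0 = refl
  coeff 1 rewrite a0 | a1 = refl
  coeff 2 rewrite a0 | a1 | a2 = refl
  coeff 3 rewrite a1 | a2 | a3 = refl
  coeff (suc (suc (suc (suc k)))) rewrite rec k = cancel (a (3 + k)) (a (2 + k))
    where
    cancel : ∀ x y → ℤ.+ 1 ℤ.* (x ℤ.+ y) ℤ.+ (ℤ.- ℤ.+ 1 ℤ.* x ℤ.+ (ℤ.- ℤ.+ 1 ℤ.* y ℤ.+ ℤ.+ 0)) ≡ ℤ.+ 0
    cancel = ℤsolve-∀

IsQuotient--x³/1-x+x² : ∀ (a : ℕ → ℤ) → a 0 ≡ ℤ.+ 0 → a 1 ≡ ℤ.+ 0 → a 2 ≡ ℤ.+ 0 → a 3 ≡ ℤ.- ℤ.+ 1 →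
                        (∀ k → a (4 + k) ≡ a (3 + k) ℤ.- a (2 + k)) → IsQuotient a -x³ 1-x+x²
IsQuotient--x³/1-x+x² a a0 a1 a2 a3 rec = coeff
  where
  coeff : IsQuotient a -x³ 1-x+x²
  coeff 0 rewrite a0 = refl
  coeff 1 rewrite a0 | a1 = refl
  coeff 2 rewrite a0 | a1 | a2 = refl
  coeff 3 rewrite a1 | a2 | a3 = refl
  coeff (suc (suc (suc (suc k)))) rewrite rec k = cancel (a (3 + k)) (a (2 + k))
    where
    cancel : ∀ x y → ℤ.+ 1 ℤ.* (x ℤ.- y) ℤ.+ (ℤ.- ℤ.+ 1 ℤ.* x ℤ.+ (ℤ.+ 1 ℤ.* y ℤ.+ ℤ.+ 0)) ≡ ℤ.+ 0
    cancel = ℤsolve-∀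

mainTheorem11 : IsQuotient (Gplus p213) x³ 1-x-x² × IsQuotient (Gplus p132) x³ 1-x-x²
    × IsQuotient (Gminus p213) -x³ 1-x+x² × IsQuotient (Gminus p132) -x³ 1-x+x²
mainTheorem11 =
    IsQuotient-x³/1-x-x² (Gplus p213) refl refl refl refl Recurrence213.Gplus-recurrence
  , IsQuotient-x³/1-x-x² (Gplus p132) refl refl refl refl Recurrence132.Gplus-recurrence
  , IsQuotient--x³/1-x+x² (Gminus p213) refl refl refl refl Recurrence213.Gminus-recurrence
  , IsQuotient--x³/1-x+x² (Gminus p132) refl refl refl refl Recurrence132.Gminus-recurrence
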